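{- Let $x_1,\dotsc,x_{m-1}$ be odd positive integers, let $p$ be a prime number that divides $x_i$ for some $i\in[m-1]$, and let $V_p=\max_{i\in[m-1]}\{v_p(x_i)\}$. For an odd positive integer $x_m$ let $y=\gcd(\sigma_{m-1}(x_1,\dotsc,x_m),x_1\dotsm x_m)$. The following statements are equivalent: (a) There exists an odd positive integer $x_m$ with $v_p(y)=v_p(x_1\dotsm x_{m-1})-V_p$. (b) There exists an odd positive integer $x_m$ with $v_p(y)=v_p(x_1\dotsm x_{m-1})+V_p$. (c) $p$ does not divide \[ \sum_{i=1}^{m-1}p^{V_p-v_p(x_i)}\prod_{\substack{1\leq j\leq m-1\\ j\neq i}}\frac{x_j}{p^{v_p(x_j)}}. \]
   Context: Here $[m]=\{1,\dotsc,m\}$, $\sigma_{m-1}(x_1,\dotsc,x_m)=\sum_{I\subseteq[m],\,|I|=m-1}\prod_{i\in I}x_i$ is the elementary symmetric polynomial of degree $m-1$, and $v_p(n)$ denotes the $p$-adic valuation of $n$. -}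

module Defs where

open import Data.Nat using (ℕ; zero; suc; _+_; _*_; _∸_; _^_; _⊔_)
open import Data.Nat.DivMod using (_/_)
open import Data.Nat.Divisibility using (_∣_; _∣?_)
open import Data.Nat.GCD using (gcd)
open import Data.Nat.Properties using (m^n≢0)
open import Data.Fin using (Fin; _≟_; fromℕ)
open import Data.Vec.Functional using (foldr; insertAt)
open import Data.Bool using (if_then_else_)
open import Relation.Nullary using (¬_; yes; no)
open import Relation.Nullary.Decidable using (⌊_⌋)

Odd : ℕ → Set
Odd n = ¬ (2 ∣ n)

Σ[_] : ∀ {k} → (Fin k → ℕ) → ℕ
Σ[ f ] = foldr _+_ 0 f

Π[_] : ∀ {k} → (Fin k → ℕ) → ℕ
Π[ f ] = foldr _*_ 1 f

Max[_] : ∀ {k} → (Fin k → ℕ) → ℕ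
Max[ f ] = foldr _⊔_ 0 f

ΠExcept : ∀ {k} → (Fin k → ℕ) → Fin k → ℕ
ΠExcept f i = Π[ (λ j → if ⌊ j ≟ i ⌋ then 1 else f j) ]

-- elementary symmetric polynomial of degree k-1 in k variables:
-- σ_{k-1}(x_1,…,x_k) = Σ_i Π_{j≠i} x_j
σtop : ∀ {k} → (Fin k → ℕ) → ℕ
σtop f = Σ[ (λ i → ΠExcept f i) ]

-- p-adic valuation with fuel: largest e with p^e ∣ n (for p ≥ 2, n ≥ 1);
-- conventionally 0 when p < 2 or n = 0.  Fuel n suffices since p^e ≤ n.
vAux : ℕ → ℕ → ℕ → ℕ
vAux zero _ _ = 0
vAux (suc f) zero n = 0
vAux (suc f) (suc zero) n = 0
vAux (suc f) (suc (suc q)) zero = 0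
vAux (suc f) (suc (suc q)) (suc n) with suc (suc q) ∣? suc n
... | yes _ = suc (vAux f (suc (suc q)) (suc n / suc (suc q)))
... | no _ = 0

v : ℕ → ℕ → ℕ
v p n = vAux n p n

pFree : ℕ → ℕ → ℕ
pFree zero n = n
pFree (suc q) n = n / (suc q ^ v (suc q) n)
  where instance _ = m^n≢0 (suc q) (v (suc q) n)

snoc : ∀ {k} → (Fin k → ℕ) → ℕ → Fin (suc k) → ℕ
snoc {k} x xm = insertAt x (fromℕ k) xm

yVal : ∀ {k} → (Fin k → ℕ) → ℕ → ℕ
yVal x xm = gcd (σtop (snoc x xm)) (Π[ snoc x xm ])

Vp : ∀ {k} → ℕ → (Fin k → ℕ) → ℕ
Vp p x = Max[ (λ i → v p (x i)) ]

cSum : ∀ {k} → ℕ → (Fin k → ℕ) → ℕ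
cSum p x = Σ[ (λ i → p ^ (Vp p x ∸ v p (x i)) * ΠExcept (λ j → pFree p (x j)) i) ]

-- Write x_i = p^{e_i} f_i with p ∤ f_i, and put A = Σ e_i, V = max e_i, k = A − V.  Then
-- P = x_1⋯x_{m-1} = p^A F with p ∤ F, and σ_{m-2}(x_1,…,x_{m-1}) = p^k C with C the sum in (c),
-- so y = gcd(x_m p^k C + P, P x_m).  Always p^k ∣ y.  If p ∣ C then p^{k+1} ∣ y for every x_m,
-- while if p ∤ C then x_m = 1 gives v_p(y) = k.  If v_p(y) = A + V then p^V ∣ x_m, and p ∣ C
-- would then force p^{A+1} ∣ P.  If p ∤ C, then C is invertible modulo p^V: for an odd t with
-- t C + F ≡ 0 (mod p^V), x_m = p^V t makes x_m p^k C + P = p^A (t C + F) and P x_m = p^{A+V} F t,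
-- so v_p(y) = A + V exactly.

{-# OPTIONS --safe #-}
module Submission where

open import Defs
open import Data.Nat using (ℕ; zero; suc; pred; _+_; _*_; _∸_; _^_; _≤_; _<_; z≤n; s≤s; s≤s⁻¹;
  NonZero; >-nonZero; nonTrivial⇒n>1)
open import Data.Nat.Properties hiding (_≟_)
open import Data.Nat.DivMod using (_/_; m*n/n≡m; m/n<m; /-congˡ)
open import Data.Nat.Divisibility
open import Data.Nat.Coprimality using (Coprime; coprime-Bézout; coprime-divisor)
import Data.Nat.Coprimality as Coprime
open import Data.Nat.GCD using (gcd; gcd-greatest; gcd[m,n]∣m; gcd[m,n]∣n; gcd[m,n]≢0; module Bézout)
open import Data.Nat.Primality using (Prime; euclidsLemma; prime[2]; prime⇒irreducible; prime⇒nonTrivial)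
open import Data.Nat.Tactic.RingSolver using (solve; solve-∀)
open import Algebra.Properties.CommutativeSemigroup *-commutativeSemigroup using (x∙yz≈y∙xz)
open import Data.Fin using (Fin; _≟_) renaming (zero to fzero; suc to fsuc)
open import Data.Bool using (true; false; if_then_else_)
open import Data.List using (_∷_; [])
open import Data.Product using (_×_; ∃-syntax; _,_; proj₁; proj₂)
open import Data.Sum using (inj₁; inj₂)
open import Data.Empty using (⊥-elim)
open import Function using (_∘_)
open import Function.Bundles using (_⇔_; mk⇔)
import Function.Properties.Equivalence as ⇔
open import Relation.Nullary using (¬_; yes; no)
open import Relation.Nullary.Decidable using (⌊_⌋; ⌊⌋-map′)
open import Relation.Binary.PropositionalEquality

∤⇒>0 : ∀ {p u} → ¬ p ∣ u → 0 < u
∤⇒>0 {p} {zero}  p∤0 = ⊥-elim (p∤0 (p ∣0))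
∤⇒>0 {p} {suc _} _   = s≤s z≤n

*-pos : ∀ {m n} → 0 < m → 0 < n → 0 < m * n
*-pos {suc _} {suc _} _ _ = s≤s z≤n

∣m+n∣n⇒∣m : ∀ {d m n} → d ∣ m + n → d ∣ n → d ∣ m
∣m+n∣n⇒∣m {d} {m} {n} d∣m+n = ∣m+n∣m⇒∣n (subst (d ∣_) (+-comm m n) d∣m+n)

^-monoʳ-∣ : ∀ p {j k} → j ≤ k → p ^ j ∣ p ^ k
^-monoʳ-∣ p {j} {k} j≤k = divides (p ^ (k ∸ j)) (begin
  p ^ k             ≡⟨ cong (p ^_) (m∸n+n≡m j≤k) ⟨
  p ^ (k ∸ j + j)   ≡⟨ ^-distribˡ-+-* p (k ∸ j) j ⟩
  p ^ (k ∸ j) * p ^ j ∎)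
  where open ≡-Reasoning

^suc∣^*⇒∣ : ∀ {p k u} .{{_ : NonZero p}} → p ^ suc k ∣ p ^ k * u → p ∣ u
^suc∣^*⇒∣ {p} {k} {u} pᵏ⁺¹∣pᵏu =
  *-cancelˡ-∣ (p ^ k) {{m^n≢0 p k}} (subst (_∣ p ^ k * u) (*-comm p (p ^ k)) pᵏ⁺¹∣pᵏu)

^∣^*⇒≤ : ∀ {p j k u} .{{_ : NonZero p}} → ¬ p ∣ u → p ^ j ∣ p ^ k * u → j ≤ k
^∣^*⇒≤ {p} {j} {k} p∤u pʲ∣pᵏu with j ≤? k
... | yes j≤k = j≤k
... | no  j≰k = ⊥-elim (p∤u (^suc∣^*⇒∣ {k = k} (∣-trans (^-monoʳ-∣ p (≰⇒> j≰k)) pʲ∣pᵏu)))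

prime⇒1<p : ∀ {p} → Prime p → 1 < p
prime⇒1<p {p} p-prime = nonTrivial⇒n>1 p {{prime⇒nonTrivial p-prime}}

odd-1 : Odd 1
odd-1 2∣1 with () ← ∣1⇒≡1 2∣1

odd-* : ∀ {a b} → Odd a → Odd b → Odd (a * b)
odd-* {a} {b} odd-a odd-b 2∣ab with euclidsLemma a b prime[2] 2∣ab
... | inj₁ 2∣a = odd-a 2∣a
... | inj₂ 2∣b = odd-b 2∣b

odd-^ : ∀ {a} → Odd a → ∀ k → Odd (a ^ k)
odd-^ odd-a zero    = odd-1
odd-^ odd-a (suc k) = odd-* odd-a (odd-^ odd-a k)

prime∤⇒coprime : ∀ {p n} → Prime p → ¬ p ∣ n → Coprime p n
prime∤⇒coprime p-prime p∤n (d∣p , d∣n) with prime⇒irreducible p-prime d∣p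
... | inj₁ d≡1 = d≡1
... | inj₂ refl = ⊥-elim (p∤n d∣n)

coprime-^ˡ : ∀ {m n} → Coprime m n → ∀ k → Coprime (m ^ k) n
coprime-^ˡ m⊥n zero    (d∣1 , _) = ∣1⇒≡1 d∣1
coprime-^ˡ m⊥n (suc k) {d} (d∣m*mᵏ , d∣n) = coprime-^ˡ m⊥n k (coprime-divisor d⊥m d∣m*mᵏ , d∣n)
  where
  d⊥m : Coprime d _
  d⊥m (e∣d , e∣m) = m⊥n (e∣m , ∣-trans e∣d d∣n)

prime^∣*⇒∣ : ∀ {p a b} j → Prime p → ¬ p ∣ a → p ^ j ∣ a * b → p ^ j ∣ b
prime^∣*⇒∣ j p-prime p∤a = coprime-divisor (coprime-^ˡ (prime∤⇒coprime p-prime p∤a) j)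

coprime⇒∃-solution : ∀ {c q} .{{_ : NonZero q}} → Coprime c q → ∀ f → ∃[ t ] (q ∣ t * c + f)
-- Bézout gives a c ≡ ∓1 (mod q); then t = a f, resp. t = (q − 1) a f, makes t c ≡ −f.
coprime⇒∃-solution {c} {q} c⊥q f with coprime-Bézout c⊥q
... | Bézout.-+ a b 1+ac≡bq = a * f , divides (f * b) (begin
  a * f * c + f   ≡⟨ solve (a ∷ f ∷ c ∷ []) ⟩
  f * (1 + a * c) ≡⟨ cong (f *_) 1+ac≡bq ⟩
  f * (b * q)     ≡⟨ *-assoc f b q ⟨
  f * b * q       ∎)
  where open ≡-Reasoning
... | Bézout.+- a b 1+bq≡ac = r * a * f , divides (f * (1 + r * b)) (begin
  r * a * f * c + f             ≡⟨ cong (_+ f) (regroup r a f c) ⟩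
  r * f * (a * c) + f           ≡⟨ cong (λ z → r * f * z + f) 1+bq≡ac ⟨
  r * f * (1 + b * q) + f       ≡⟨ cong (λ z → r * f * (1 + b * z) + f) q≡1+r ⟩
  r * f * (1 + b * suc r) + f   ≡⟨ factor r f b ⟩
  f * (1 + r * b) * suc r       ≡⟨ cong (f * (1 + r * b) *_) q≡1+r ⟨
  f * (1 + r * b) * q           ∎)
  where
  open ≡-Reasoning
  r = pred q
  q≡1+r : q ≡ suc r
  q≡1+r = sym (suc-pred q)
  regroup : ∀ r a f c → r * a * f * c ≡ r * f * (a * c)
  regroup = solve-∀
  factor : ∀ r f b → r * f * (1 + b * suc r) + f ≡ f * (1 + r * b) * suc r
  factor = solve-∀

odd-coprime⇒∃-odd-solution : ∀ {c q} .{{_ : NonZero q}} → Odd q → Coprime c q →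
  ∀ f → ∃[ t ] (Odd t × q ∣ t * c + f)
odd-coprime⇒∃-odd-solution {c} {q} odd-q c⊥q f with coprime⇒∃-solution c⊥q f
... | t , q∣tc+f with 2 ∣? t
...   | no  odd-t = t , odd-t , q∣tc+f
...   | yes 2∣t   = t + q , odd-t+q , subst (q ∣_) (sym shift) (∣m∣n⇒∣m+n q∣tc+f (m∣m*n c))
  where
  odd-t+q : Odd (t + q)
  odd-t+q 2∣t+q = odd-q (∣m+n∣m⇒∣n 2∣t+q 2∣t)
  shift : (t + q) * c + f ≡ (t * c + f) + q * c
  shift = solve (t ∷ q ∷ c ∷ f ∷ [])

vAux-spec : ∀ fuel q n → 0 < n → n ≤ fuel →
  ∃[ u ] (n ≡ suc (suc q) ^ vAux fuel (suc (suc q)) n * u × ¬ suc (suc q) ∣ u)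
vAux-spec zero       q n       0<n n≤0      = ⊥-elim (<⇒≱ 0<n n≤0)
vAux-spec (suc fuel) q (suc n) _   n≤fuel with suc (suc q) ∣? suc n
... | no  p∤n = suc n , sym (*-identityˡ (suc n)) , p∤n
... | yes p∣n = u , n≡pʷ⁺¹u , proj₂ (proj₂ ih)
  where
  open ≡-Reasoning
  p m : ℕ
  p = suc (suc q)
  m = suc n / p
  n≡mp : suc n ≡ m * p
  n≡mp = trans (m∣n⇒n≡quotient*m p∣n) (cong (_* p) (sym (n/m≡quotient p∣n)))
  0<m : 0 < m
  0<m = n≢0⇒n>0 (λ m≡0 → 1+n≢0 (trans n≡mp (cong (_* p) m≡0)))
  m<n : m < suc n
  m<n = m/n<m (suc n) p (s≤s (s≤s z≤n))
  w : ℕ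
  w = vAux fuel p m
  ih : ∃[ u ] (m ≡ p ^ w * u × ¬ p ∣ u)
  ih = vAux-spec fuel q m 0<m (≤-trans (s≤s⁻¹ m<n) (s≤s⁻¹ n≤fuel))
  u : ℕ
  u = proj₁ ih
  n≡pʷ⁺¹u : suc n ≡ p ^ suc w * u
  n≡pʷ⁺¹u = begin
    suc n             ≡⟨ n≡mp ⟩
    m * p             ≡⟨ cong (_* p) (proj₁ (proj₂ ih)) ⟩
    p ^ w * u * p     ≡⟨ *-comm (p ^ w * u) p ⟩
    p * (p ^ w * u)   ≡⟨ *-assoc p (p ^ w) u ⟨
    p * p ^ w * u     ∎

v-spec : ∀ {p n} → 1 < p → 0 < n → ∃[ u ] (n ≡ p ^ v p n * u × ¬ p ∣ u)
v-spec {suc (suc q)} {n} _ 0<n = vAux-spec n q n 0<n ≤-refl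
v-spec {suc zero} (s≤s ())

pFree-spec : ∀ {p n} → 1 < p → 0 < n → n ≡ p ^ v p n * pFree p n × ¬ p ∣ pFree p n
pFree-spec {suc q} {n} 1<p 0<n with v-spec 1<p 0<n
... | u , n≡pᵛu , p∤u =
  subst (λ z → n ≡ p ^ v p n * z) (sym pFree≡u) n≡pᵛu , subst (λ z → ¬ p ∣ z) (sym pFree≡u) p∤u
  where
  p = suc q
  instance
    pᵛ≢0 : NonZero (p ^ v p n)
    pᵛ≢0 = m^n≢0 p (v p n)
  pFree≡u : pFree p n ≡ u
  pFree≡u = begin
    n / p ^ v p n             ≡⟨ /-congˡ n≡pᵛu ⟩
    p ^ v p n * u / p ^ v p n ≡⟨ /-congˡ (*-comm (p ^ v p n) u) ⟩
    u * p ^ v p n / p ^ v p n ≡⟨ m*n/n≡m u (p ^ v p n) ⟩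
    u                         ∎
    where open ≡-Reasoning

module Valuation {p} (1<p : 1 < p) where

  private instance
    p≢0 : NonZero p
    p≢0 = >-nonZero (<-trans (s≤s z≤n) 1<p)

  ^∣⇒≤v : ∀ {j n} → 0 < n → p ^ j ∣ n → j ≤ v p n
  ^∣⇒≤v {j} 0<n pʲ∣n with v-spec 1<p 0<n
  ... | u , n≡pᵛu , p∤u = ^∣^*⇒≤ p∤u (subst (p ^ j ∣_) n≡pᵛu pʲ∣n)

  ≤v⇒^∣ : ∀ {j n} → 0 < n → j ≤ v p n → p ^ j ∣ n
  ≤v⇒^∣ {j} {n} 0<n j≤v with v-spec 1<p 0<n
  ... | u , n≡pᵛu , _ = ∣-trans (^-monoʳ-∣ p j≤v) (divides u (trans n≡pᵛu (*-comm (p ^ v p n) u)))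

  v-unique : ∀ {k n} → 0 < n → p ^ k ∣ n → ¬ p ^ suc k ∣ n → v p n ≡ k
  v-unique 0<n pᵏ∣n pᵏ⁺¹∤n =
    ≤-antisym (≮⇒≥ (λ k<v → pᵏ⁺¹∤n (≤v⇒^∣ 0<n k<v))) (^∣⇒≤v 0<n pᵏ∣n)

  v[pᵏ*u]≡k : ∀ {k u} → ¬ p ∣ u → v p (p ^ k * u) ≡ k
  v[pᵏ*u]≡k {k} {u} p∤u =
    v-unique (*-pos (m^n>0 p k) (∤⇒>0 p∤u)) (m∣m*n u) (1+n≰n ∘ ^∣^*⇒≤ {k = k} p∤u)

Σ-cong : ∀ {k} {f g : Fin k → ℕ} → (∀ i → f i ≡ g i) → Σ[ f ] ≡ Σ[ g ]
Σ-cong {zero}  f≗g = refl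
Σ-cong {suc k} f≗g = cong₂ _+_ (f≗g fzero) (Σ-cong (f≗g ∘ fsuc))

Π-cong : ∀ {k} {f g : Fin k → ℕ} → (∀ i → f i ≡ g i) → Π[ f ] ≡ Π[ g ]
Π-cong {zero}  f≗g = refl
Π-cong {suc k} f≗g = cong₂ _*_ (f≗g fzero) (Π-cong (f≗g ∘ fsuc))

*-distribˡ-Σ : ∀ {k} c (f : Fin k → ℕ) → c * Σ[ f ] ≡ Σ[ (λ i → c * f i) ]
*-distribˡ-Σ {zero}  c f = *-zeroʳ c
*-distribˡ-Σ {suc k} c f = trans (*-distribˡ-+ c (f fzero) _) (cong (c * f fzero +_) (*-distribˡ-Σ c (f ∘ fsuc)))

Π-* : ∀ {k} (f g : Fin k → ℕ) → Π[ (λ i → f i * g i) ] ≡ Π[ f ] * Π[ g ]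
Π-* {zero}  f g = refl
Π-* {suc k} f g = trans (cong (f fzero * g fzero *_) (Π-* (f ∘ fsuc) (g ∘ fsuc)))
                        ([m*n]*[o*p]≡[m*o]*[n*p] (f fzero) (g fzero) Π[ f ∘ fsuc ] Π[ g ∘ fsuc ])

Π-^ : ∀ {k} p (e : Fin k → ℕ) → Π[ (λ i → p ^ e i) ] ≡ p ^ Σ[ e ]
Π-^ {zero}  p e = refl
Π-^ {suc k} p e = trans (cong (p ^ e fzero *_) (Π-^ p (e ∘ fsuc))) (sym (^-distribˡ-+-* p (e fzero) Σ[ e ∘ fsuc ]))

ΠExcept-suc : ∀ {k} (f : Fin (suc k) → ℕ) (i : Fin k) → ΠExcept f (fsuc i) ≡ f fzero * ΠExcept (f ∘ fsuc) i
ΠExcept-suc f i =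
  cong (f fzero *_) (Π-cong (λ j → cong (λ b → if b then 1 else f (fsuc j)) (⌊⌋-map′ _ _ (j ≟ i))))

ΠExcept-cong : ∀ {k} {f g : Fin k → ℕ} → (∀ i → f i ≡ g i) → ∀ i → ΠExcept f i ≡ ΠExcept g i
ΠExcept-cong f≗g i = Π-cong (λ j → cong (if ⌊ j ≟ i ⌋ then 1 else_) (f≗g j))

ΠExcept-* : ∀ {k} (f g : Fin k → ℕ) i → ΠExcept (λ j → f j * g j) i ≡ ΠExcept f i * ΠExcept g i
ΠExcept-* f g i = trans (Π-cong (λ j → if-* ⌊ j ≟ i ⌋ (f j) (g j)))
  (Π-* (λ j → if ⌊ j ≟ i ⌋ then 1 else f j) (λ j → if ⌊ j ≟ i ⌋ then 1 else g j))
  where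
  if-* : ∀ b m n → (if b then 1 else m * n) ≡ (if b then 1 else m) * (if b then 1 else n)
  if-* true  m n = refl
  if-* false m n = refl

*-ΠExcept : ∀ {k} (f : Fin k → ℕ) i → f i * ΠExcept f i ≡ Π[ f ]
*-ΠExcept f fzero    = cong (f fzero *_) (*-identityˡ _)
*-ΠExcept f (fsuc i) = begin
  f (fsuc i) * ΠExcept f (fsuc i)               ≡⟨ cong (f (fsuc i) *_) (ΠExcept-suc f i) ⟩
  f (fsuc i) * (f fzero * ΠExcept (f ∘ fsuc) i) ≡⟨ x∙yz≈y∙xz (f (fsuc i)) (f fzero) _ ⟩
  f fzero * (f (fsuc i) * ΠExcept (f ∘ fsuc) i) ≡⟨ cong (f fzero *_) (*-ΠExcept (f ∘ fsuc) i) ⟩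
  f fzero * Π[ f ∘ fsuc ]                       ∎
  where open ≡-Reasoning

σtop-suc : ∀ {k} (f : Fin (suc k) → ℕ) → σtop f ≡ Π[ f ∘ fsuc ] + f fzero * σtop (f ∘ fsuc)
σtop-suc f = cong₂ _+_ (*-identityˡ _)
  (trans (Σ-cong (ΠExcept-suc f)) (sym (*-distribˡ-Σ (f fzero) (ΠExcept (f ∘ fsuc)))))

Π-snoc : ∀ {k} (x : Fin k → ℕ) xm → Π[ snoc x xm ] ≡ Π[ x ] * xm
Π-snoc {zero}  x xm = *-comm xm 1
Π-snoc {suc k} x xm = trans (cong (x fzero *_) (Π-snoc (x ∘ fsuc) xm)) (sym (*-assoc (x fzero) _ xm))

σtop-snoc : ∀ {k} (x : Fin k → ℕ) xm → σtop (snoc x xm) ≡ xm * σtop x + Π[ x ]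
σtop-snoc {zero}  x xm = cong (_+ 1) (sym (*-zeroʳ xm))
σtop-snoc {suc k} x xm = begin
  σtop (snoc x xm)                                 ≡⟨ σtop-suc (snoc x xm) ⟩
  Π[ snoc t xm ] + x fzero * σtop (snoc t xm)
    ≡⟨ cong₂ (λ a b → a + x fzero * b) (Π-snoc t xm) (σtop-snoc t xm) ⟩
  Π[ t ] * xm + x fzero * (xm * σtop t + Π[ t ])   ≡⟨ rearrange Π[ t ] (x fzero) xm (σtop t) ⟩
  xm * (Π[ t ] + x fzero * σtop t) + x fzero * Π[ t ] ≡⟨ cong (λ s → xm * s + Π[ x ]) (σtop-suc x) ⟨
  xm * σtop x + Π[ x ]                             ∎
  where
  open ≡-Reasoning
  t : Fin k → ℕ
  t = x ∘ fsuc
  rearrange : ∀ P a m s → P * m + a * (m * s + P) ≡ m * (P + a * s) + a * P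
  rearrange = solve-∀

Max-ub : ∀ {k} (e : Fin k → ℕ) i → e i ≤ Max[ e ]
Max-ub e fzero    = m≤m⊔n _ _
Max-ub e (fsuc i) = ≤-trans (Max-ub (e ∘ fsuc) i) (m≤n⊔m _ _)

Max≤Σ : ∀ {k} (e : Fin k → ℕ) → Max[ e ] ≤ Σ[ e ]
Max≤Σ {zero}  e = z≤n
Max≤Σ {suc k} e = ⊔-lub (m≤m+n _ _) (≤-trans (Max≤Σ (e ∘ fsuc)) (m≤n+m _ _))

prime∤Π : ∀ {p k} → Prime p → (f : Fin k → ℕ) → (∀ i → ¬ p ∣ f i) → ¬ p ∣ Π[ f ]
prime∤Π {k = zero}  p-prime f _ p∣1 = <-irrefl (sym (∣1⇒≡1 p∣1)) (prime⇒1<p p-prime)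
prime∤Π {k = suc k} p-prime f p∤f p∣Π with euclidsLemma (f fzero) _ p-prime p∣Π
... | inj₁ p∣f0 = p∤f fzero p∣f0
... | inj₂ p∣Πt = prime∤Π p-prime (f ∘ fsuc) (p∤f ∘ fsuc) p∣Πt

p^W*σtop≡ : ∀ {k} p (x e f : Fin k → ℕ) W → (∀ i → x i ≡ p ^ e i * f i) → (∀ i → e i ≤ W) →
  p ^ W * σtop x ≡ p ^ Σ[ e ] * Σ[ (λ i → p ^ (W ∸ e i) * ΠExcept f i) ]
p^W*σtop≡ {k} p x e f W x≡pᵉf e≤W = begin
  p ^ W * σtop x                                      ≡⟨ *-distribˡ-Σ (p ^ W) (ΠExcept x) ⟩
  Σ[ (λ i → p ^ W * ΠExcept x i) ]                    ≡⟨ Σ-cong term ⟩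
  Σ[ (λ i → p ^ Σ[ e ] * (p ^ (W ∸ e i) * ΠExcept f i)) ]
    ≡⟨ *-distribˡ-Σ (p ^ Σ[ e ]) (λ i → p ^ (W ∸ e i) * ΠExcept f i) ⟨
  p ^ Σ[ e ] * Σ[ (λ i → p ^ (W ∸ e i) * ΠExcept f i) ] ∎
  where
  open ≡-Reasoning
  pᵉ : Fin k → ℕ
  pᵉ i = p ^ e i
  reassoc : ∀ a b c d → a * b * (c * d) ≡ a * (b * c * d)
  reassoc = solve-∀
  term : ∀ i → p ^ W * ΠExcept x i ≡ p ^ Σ[ e ] * (p ^ (W ∸ e i) * ΠExcept f i)
  term i = begin
    p ^ W * ΠExcept x i
      ≡⟨ cong₂ _*_ (trans (cong (p ^_) (sym (m∸n+n≡m (e≤W i)))) (^-distribˡ-+-* p (W ∸ e i) (e i)))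
                   (trans (ΠExcept-cong x≡pᵉf i) (ΠExcept-* pᵉ f i)) ⟩
    p ^ (W ∸ e i) * p ^ e i * (ΠExcept pᵉ i * ΠExcept f i)
      ≡⟨ reassoc (p ^ (W ∸ e i)) (p ^ e i) (ΠExcept pᵉ i) (ΠExcept f i) ⟩
    p ^ (W ∸ e i) * (p ^ e i * ΠExcept pᵉ i * ΠExcept f i)
      ≡⟨ cong (λ z → p ^ (W ∸ e i) * (z * ΠExcept f i)) (trans (*-ΠExcept pᵉ i) (Π-^ p e)) ⟩
    p ^ (W ∸ e i) * (p ^ Σ[ e ] * ΠExcept f i)
      ≡⟨ x∙yz≈y∙xz (p ^ (W ∸ e i)) (p ^ Σ[ e ]) (ΠExcept f i) ⟩
    p ^ Σ[ e ] * (p ^ (W ∸ e i) * ΠExcept f i)        ∎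

module PAdicDecomposition {n} (x : Fin n → ℕ) {p} (p-prime : Prime p) (0<x : ∀ i → 0 < x i) where

  private
    1<p : 1 < p
    1<p = prime⇒1<p p-prime
    instance
      p≢0 : NonZero p
      p≢0 = >-nonZero (<-trans (s≤s z≤n) 1<p)

  e f : Fin n → ℕ
  e i = v p (x i)
  f i = pFree p (x i)

  V k : ℕ
  V = Vp p x
  k = Σ[ e ] ∸ V

  x≡pᵉf : ∀ i → x i ≡ p ^ e i * f i
  x≡pᵉf i = proj₁ (pFree-spec 1<p (0<x i))

  p∤Π[f] : ¬ p ∣ Π[ f ]
  p∤Π[f] = prime∤Π p-prime f (λ i → proj₂ (pFree-spec 1<p (0<x i)))

  k+V≡Σe : k + V ≡ Σ[ e ]
  k+V≡Σe = m∸n+n≡m (Max≤Σ e)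

  Π[x]≡ : Π[ x ] ≡ p ^ (k + V) * Π[ f ]
  Π[x]≡ = begin
    Π[ x ]                        ≡⟨ Π-cong x≡pᵉf ⟩
    Π[ (λ i → p ^ e i * f i) ]    ≡⟨ Π-* (λ i → p ^ e i) f ⟩
    Π[ (λ i → p ^ e i) ] * Π[ f ] ≡⟨ cong (_* Π[ f ]) (trans (Π-^ p e) (cong (p ^_) (sym k+V≡Σe))) ⟩
    p ^ (k + V) * Π[ f ]          ∎
    where open ≡-Reasoning

  σtop[x]≡ : σtop x ≡ p ^ k * cSum p x
  σtop[x]≡ = *-cancelˡ-≡ (σtop x) (p ^ k * cSum p x) (p ^ V) {{m^n≢0 p V}} (begin
    p ^ V * σtop x              ≡⟨ p^W*σtop≡ p x e f V x≡pᵉf (Max-ub e) ⟩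
    p ^ Σ[ e ] * cSum p x       ≡⟨ cong (λ z → p ^ z * cSum p x) (trans (sym k+V≡Σe) (+-comm k V)) ⟩
    p ^ (V + k) * cSum p x      ≡⟨ cong (_* cSum p x) (^-distribˡ-+-* p V k) ⟩
    p ^ V * p ^ k * cSum p x    ≡⟨ *-assoc (p ^ V) (p ^ k) (cSum p x) ⟩
    p ^ V * (p ^ k * cSum p x)  ∎)
    where open ≡-Reasoning

module GcdValuation {p} (p-prime : Prime p) (k V C F : ℕ) (0<V : 0 < V) (p∤F : ¬ p ∣ F) where

  private
    1<p : 1 < p
    1<p = prime⇒1<p p-prime
    instance
      p≢0 : NonZero p
      p≢0 = >-nonZero (<-trans (s≤s z≤n) 1<p)

  open Valuation 1<p

  A S P : ℕ
  A = k + V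
  S = p ^ k * C
  P = p ^ A * F

  y : ℕ → ℕ
  y t = gcd (t * S + P) (P * t)

  Attained : ℕ → Set
  Attained n = ∃[ t ] (Odd t × 0 < t × v p (y t) ≡ n)

  private
    0<y : ∀ t → 0 < y t
    0<y t = n≢0⇒n>0 (gcd[m,n]≢0 (t * S + P) (P * t) (inj₁ (m<n⇒n≢0 (<-≤-trans 0<P (m≤n+m P (t * S))))))
      where
      0<P : 0 < P
      0<P = *-pos (m^n>0 p A) (∤⇒>0 p∤F)

    ∣y : ∀ {d} t → d ∣ t * S + P → d ∣ P * t → d ∣ y t
    ∣y t = gcd-greatest

    y∣N : ∀ t → y t ∣ t * S + P
    y∣N t = gcd[m,n]∣m (t * S + P) (P * t)

    y∣M : ∀ t → y t ∣ P * t
    y∣M t = gcd[m,n]∣n (t * S + P) (P * t)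

    k<A : k < A
    k<A = m<m+n k 0<V

    pᵏ⁺¹∣P : p ^ suc k ∣ P
    pᵏ⁺¹∣P = ∣-trans (^-monoʳ-∣ p (k<A)) (m∣m*n F)

    pᴬ⁺¹∤P : ¬ p ^ suc A ∣ P
    pᴬ⁺¹∤P = 1+n≰n ∘ ^∣^*⇒≤ {k = A} p∤F

    p∣C⇒pᵏ⁺¹∣S : p ∣ C → p ^ suc k ∣ S
    p∣C⇒pᵏ⁺¹∣S p∣C = subst (_∣ S) (*-comm (p ^ k) p) (*-monoʳ-∣ (p ^ k) p∣C)

  p∣C⇒k<v[y] : p ∣ C → ∀ t → k < v p (y t)
  p∣C⇒k<v[y] p∣C t =
    ^∣⇒≤v (0<y t) (∣y t (∣m∣n⇒∣m+n (∣n⇒∣m*n t (p∣C⇒pᵏ⁺¹∣S p∣C)) pᵏ⁺¹∣P) (∣m⇒∣m*n t pᵏ⁺¹∣P))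

  p∤C⇒v[y1]≡k : ¬ p ∣ C → v p (y 1) ≡ k
  p∤C⇒v[y1]≡k p∤C = v-unique (0<y 1) pᵏ∣y1 (p∤C ∘ ^suc∣^*⇒∣ {k = k} ∘ pᵏ⁺¹∣S)
    where
    pᵏ∣P : p ^ k ∣ P
    pᵏ∣P = ∣-trans (^-monoʳ-∣ p (m≤m+n k V)) (m∣m*n F)
    pᵏ∣y1 : p ^ k ∣ y 1
    pᵏ∣y1 = ∣y 1 (∣m∣n⇒∣m+n (∣n⇒∣m*n 1 (m∣m*n C)) pᵏ∣P) (∣m⇒∣m*n 1 pᵏ∣P)
    pᵏ⁺¹∣S : p ^ suc k ∣ y 1 → p ^ suc k ∣ S
    pᵏ⁺¹∣S pᵏ⁺¹∣y1 = subst (p ^ suc k ∣_) (*-identityˡ S)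
      (∣m+n∣n⇒∣m (∣-trans pᵏ⁺¹∣y1 (y∣N 1)) pᵏ⁺¹∣P)

  v[y]≡A+V⇒p∤C : ∀ t → v p (y t) ≡ A + V → ¬ p ∣ C
  v[y]≡A+V⇒p∤C t v≡A+V p∣C = pᴬ⁺¹∤P (∣m+n∣m⇒∣n pᴬ⁺¹∣N pᴬ⁺¹∣tS)
    where
    pᴬ⁺ⱽ∣y : p ^ (A + V) ∣ y t
    pᴬ⁺ⱽ∣y = ≤v⇒^∣ (0<y t) (≤-reflexive (sym v≡A+V))
    pⱽ∣t : p ^ V ∣ t
    pⱽ∣t = prime^∣*⇒∣ V p-prime p∤F (*-cancelˡ-∣ (p ^ A) {{m^n≢0 p A}}
      (subst₂ _∣_ (^-distribˡ-+-* p A V) (*-assoc (p ^ A) F t) (∣-trans pᴬ⁺ⱽ∣y (y∣M t))))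
    pᴬ⁺¹∣tS : p ^ suc A ∣ t * S
    pᴬ⁺¹∣tS = subst₂ _∣_ (sym (^-distribˡ-+-* p (suc k) V)) (*-comm S t) (*-pres-∣ (p∣C⇒pᵏ⁺¹∣S p∣C) pⱽ∣t)
    pᴬ⁺¹∣N : p ^ suc A ∣ t * S + P
    pᴬ⁺¹∣N = ∣-trans (^-monoʳ-∣ p (m<m+n A 0<V)) (∣-trans pᴬ⁺ⱽ∣y (y∣N t))

  p∤C⇒Attained[A+V] : Odd p → ¬ p ∣ C → Attained (A + V)
  p∤C⇒Attained[A+V] odd-p p∤C
    with odd-coprime⇒∃-odd-solution {{m^n≢0 p V}} (odd-^ odd-p V)
           (Coprime.sym (coprime-^ˡ (prime∤⇒coprime p-prime p∤C) V)) F
  ... | t , odd-t , pⱽ∣tC+F = p ^ V * t , odd-* (odd-^ odd-p V) odd-t , *-pos (m^n>0 p V) (∤⇒>0 odd-t) ,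
                              v-unique (0<y (p ^ V * t)) pᴬ⁺ⱽ∣y pᴬ⁺ⱽ⁺¹∤y
    where
    open ≡-Reasoning
    xm : ℕ
    xm = p ^ V * t
    factor : ∀ a b t c f → a * t * (b * c) + b * a * f ≡ b * a * (t * c + f)
    factor = solve-∀
    N≡ : xm * S + P ≡ p ^ A * (t * C + F)
    N≡ = begin
      p ^ V * t * (p ^ k * C) + p ^ A * F         ≡⟨ cong (λ z → xm * S + z * F) (^-distribˡ-+-* p k V) ⟩
      p ^ V * t * (p ^ k * C) + p ^ k * p ^ V * F ≡⟨ factor (p ^ V) (p ^ k) t C F ⟩
      p ^ k * p ^ V * (t * C + F)                 ≡⟨ cong (_* (t * C + F)) (^-distribˡ-+-* p k V) ⟨
      p ^ A * (t * C + F)                         ∎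
    M≡ : P * xm ≡ p ^ (A + V) * (F * t)
    M≡ = trans ([m*n]*[o*p]≡[m*o]*[n*p] (p ^ A) F (p ^ V) t) (cong (_* (F * t)) (sym (^-distribˡ-+-* p A V)))
    pᴬ⁺ⱽ∣y : p ^ (A + V) ∣ y xm
    pᴬ⁺ⱽ∣y = ∣y xm (subst₂ _∣_ (sym (^-distribˡ-+-* p A V)) (sym N≡) (*-monoʳ-∣ (p ^ A) pⱽ∣tC+F))
                   (subst (p ^ (A + V) ∣_) (sym M≡) (m∣m*n (F * t)))
    p∣pⱽ : p ∣ p ^ V
    p∣pⱽ = subst (_∣ p ^ V) (*-identityʳ p) (^-monoʳ-∣ p 0<V)
    pᴬ⁺ⱽ⁺¹∤y : ¬ p ^ suc (A + V) ∣ y xm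
    pᴬ⁺ⱽ⁺¹∤y pᴬ⁺ⱽ⁺¹∣y
      with euclidsLemma F t p-prime
             (^suc∣^*⇒∣ {k = A + V} (subst (p ^ suc (A + V) ∣_) M≡ (∣-trans pᴬ⁺ⱽ⁺¹∣y (y∣M xm))))
    ... | inj₁ p∣F = p∤F p∣F
    ... | inj₂ p∣t = p∤F (∣m+n∣m⇒∣n (∣-trans p∣pⱽ pⱽ∣tC+F) (∣m⇒∣m*n C p∣t))

  Attained[k]⇔p∤C : Attained k ⇔ (¬ p ∣ C)
  Attained[k]⇔p∤C = mk⇔
    (λ (t , _ , _ , v≡k) p∣C → n≮n k (subst (k <_) v≡k (p∣C⇒k<v[y] p∣C t)))
    (λ p∤C → 1 , odd-1 , s≤s z≤n , p∤C⇒v[y1]≡k p∤C)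

  Attained[A+V]⇔p∤C : Odd p → Attained (A + V) ⇔ (¬ p ∣ C)
  Attained[A+V]⇔p∤C odd-p = mk⇔ (λ (t , _ , _ , v≡A+V) → v[y]≡A+V⇒p∤C t v≡A+V) (p∤C⇒Attained[A+V] odd-p)

∃-v-cong : ∀ {p a b} {g h : ℕ → ℕ} → (∀ t → g t ≡ h t) → a ≡ b →
  (∃[ t ] (Odd t × 0 < t × v p (g t) ≡ a)) ⇔ (∃[ t ] (Odd t × 0 < t × v p (h t) ≡ b))
∃-v-cong {p} g≗h a≡b = mk⇔
  (λ (t , odd-t , 0<t , v≡a) → t , odd-t , 0<t , trans (cong (v p) (sym (g≗h t))) (trans v≡a a≡b))
  (λ (t , odd-t , 0<t , v≡b) → t , odd-t , 0<t , trans (cong (v p) (g≗h t)) (trans v≡b (sym a≡b)))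

proposition4p7 : (n : ℕ) (x : Fin n → ℕ) (p : ℕ) →
    (∀ i → Odd (x i)) → (∀ i → 0 < x i) →
    Prime p → (∃[ i ] (p ∣ x i)) →
    ((∃[ xm ] (Odd xm × 0 < xm × v p (yVal x xm) ≡ v p Π[ x ] ∸ Vp p x))
      ⇔ (∃[ xm ] (Odd xm × 0 < xm × v p (yVal x xm) ≡ v p Π[ x ] + Vp p x)))
    × ((∃[ xm ] (Odd xm × 0 < xm × v p (yVal x xm) ≡ v p Π[ x ] + Vp p x))
      ⇔ (¬ (p ∣ cSum p x)))
proposition4p7 n x p odd-x 0<x p-prime (i₀ , p∣xᵢ₀) = ⇔.trans a⇔c (⇔.sym b⇔c) , b⇔c
  where
  open PAdicDecomposition x p-prime 0<x
  open Valuation (prime⇒1<p p-prime)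

  0<V : 0 < V
  0<V = ≤-trans (^∣⇒≤v (0<x i₀) (subst (_∣ x i₀) (sym (*-identityʳ p)) p∣xᵢ₀)) (Max-ub e i₀)

  open GcdValuation p-prime k V (cSum p x) Π[ f ] 0<V p∤Π[f]

  yVal≡y : ∀ t → yVal x t ≡ y t
  yVal≡y t = cong₂ gcd (trans (σtop-snoc x t) (cong₂ (λ a b → t * a + b) σtop[x]≡ Π[x]≡))
                       (trans (Π-snoc x t) (cong (_* t) Π[x]≡))

  v[Π[x]]≡A : v p Π[ x ] ≡ A
  v[Π[x]]≡A = trans (cong (v p) Π[x]≡) (v[pᵏ*u]≡k p∤Π[f])

  odd-p : Odd p
  odd-p 2∣p = odd-x i₀ (∣-trans 2∣p p∣xᵢ₀)

  Attainedₓ : ℕ → Set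
  Attainedₓ m = ∃[ xm ] (Odd xm × 0 < xm × v p (yVal x xm) ≡ m)

  a⇔c : Attainedₓ (v p Π[ x ] ∸ V) ⇔ (¬ p ∣ cSum p x)
  a⇔c = ⇔.trans (∃-v-cong yVal≡y (trans (cong (_∸ V) v[Π[x]]≡A) (m+n∸n≡m k V))) Attained[k]⇔p∤C
  b⇔c : Attainedₓ (v p Π[ x ] + V) ⇔ (¬ p ∣ cSum p x)
  b⇔c = ⇔.trans (∃-v-cong yVal≡y (cong (_+ V) v[Π[x]]≡A)) (Attained[A+V]⇔p∤C odd-p)
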